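{- Let $p,q,s,u,v,w,t$ be parameters with $t\ne0$ and let $(a_n)_{n\ge0}$ be defined by $a_0=1$, $a_1=p$, $a_2=q$, $a_3=s$ and, for $n\ge4$, $$a_n=u\,a_{n-1}+v\,a_{n-2}+w\,a_{n-3}+t\sum_{k=1}^{n-4}a_ka_{n-k-3}.$$ Writing $N(x)=1+(p-u)x-(v+pu-q)x^2-(w-s-t+qu+pv)x^3$ and $D(x)=1-ux-vx^2-(w-2t)x^3$, the generating function of $(a_n)$ is $$\frac{N(x)}{D(x)}\;c\!\left(\frac{tx^3N(x)}{D(x)^2}\right).$$
   Context: $c(x)=\frac{1-\sqrt{1-4x}}{2x}=\sum_{n\ge0}C_nx^n$ is the generating function of the Catalan numbers $C_n=\frac{1}{n+1}\binom{2n}{n}$. The sum in the recurrence is $a_1a_{n-4}+\dots+a_{n-4}a_1$ (empty for $n=4$). -}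

module Defs where

open import Level using (Level)
open import Data.Nat using (ℕ; zero; suc; _∸_)
open import Data.Nat.DivMod using (_/_)
open import Data.Nat.Combinatorics using (_C_)
open import Algebra.Bundles using (CommutativeRing)

catalan : ℕ → ℕ
catalan n = ((n Data.Nat.+ n) C n) / suc n

-- Formal power series over a commutative ring R, represented by their
-- coefficient sequences ℕ → Carrier (equality is coefficientwise ≈).
module PowerSeries {c ℓ : Level} (R : CommutativeRing c ℓ) where
  open CommutativeRing R

  PS : Set c
  PS = ℕ → Carrier

  sumTo : ℕ → (ℕ → Carrier) → Carrier
  sumTo zero    f = 0#
  sumTo (suc n) f = sumTo n f + f n

  fromℕ : ℕ → Carrier
  fromℕ zero    = 0#
  fromℕ (suc n) = 1# + fromℕ n

  cubic : Carrier → Carrier → Carrier → Carrier → PS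
  cubic c0 c1 c2 c3 0 = c0
  cubic c0 c1 c2 c3 1 = c1
  cubic c0 c1 c2 c3 2 = c2
  cubic c0 c1 c2 c3 3 = c3
  cubic c0 c1 c2 c3 (suc (suc (suc (suc _)))) = 0#

  cx³ : Carrier → PS
  cx³ k = cubic 0# 0# 0# k

  oneS : PS
  oneS 0 = 1#
  oneS (suc _) = 0#

  _⊛_ : PS → PS → PS
  (f ⊛ g) n = sumTo (suc n) (λ i → f i * g (n ∸ i))

  infixl 7 _⊛_

  _⊖_ : PS → PS → PS
  (f ⊖ g) n = f n - g n

  pow : PS → ℕ → PS
  pow g zero    = oneS
  pow g (suc k) = g ⊛ pow g k

  -- Multiplicative inverse of a series f with f(0) = 1:
  -- 1/f = 1/(1 - g) = Σ_k g^k with g = 1 - f (g has zero constant term,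
  -- so g^k contributes to x^n only for k ≤ n).
  recip : PS → PS
  recip f n = sumTo (suc n) (λ k → pow (oneS ⊖ f) k n)

  -- Composition c(y) = Σ_k C_k y^k, for y with zero constant term.
  catalanOf : PS → PS
  catalanOf y n = sumTo (suc n) (λ k → fromℕ (catalan k) * pow y k n)

  module _ (p q s u v w t : Carrier) where
    Npoly : PS
    Npoly = cubic 1# (p - u) (- (v + p * u - q))
                     (- (w - s - t + q * u + p * v))

    Dpoly : PS
    Dpoly = cubic 1# (- u) (- v) (- (w - (t + t)))

    genFun : PS
    genFun = (Npoly ⊛ recip Dpoly)
             ⊛ catalanOf (cx³ t ⊛ Npoly ⊛ recip Dpoly ⊛ recip Dpoly)

module Submission where

open import Defs
open import Level using (Level)
open import Data.Nat using (ℕ; suc)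
open import Relation.Nullary using (¬_)
open import Algebra.Bundles using (CommutativeRing)

-- Put R = 1/D and Y = t x³ N R², so that G = N R c(Y).  Catalan's equation
-- c = 1 + Y c² gives the functional equation
--   D G = N c(Y) = N + t x³ (N R c(Y))² = N + t x³ G².
-- Comparing coefficients shows that the coefficients of G start with 1, p, q, s and satisfy
-- the recurrence; since a solution of the recurrence is determined by its first four terms,
-- (aₙ) is the coefficient sequence of G.

module CatalanNumbers where
  open import Data.Nat
  open import Data.Nat.Properties
  open import Data.Nat.DivMod using (m*n/n≡m; m/n*n≡m)
  open import Data.Nat.Combinatorics
    using (_C_; nCk≡n!/k![n-k]!; k>n⇒nCk≡0; nCk≡nC[n∸k]; nCk+nC[k+1]≡[n+1]C[k+1];
           k![n∸k]!∣n!; [n-k]*d[k+1]≡[k+1]*d[k])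
  open import Data.Nat.Tactic.RingSolver using (solve-∀)
  open import Relation.Binary.PropositionalEquality
  open import Relation.Binary.Definitions using (tri<; tri≈; tri>)
  open ≡-Reasoning

  binomial-factorials : ∀ {n k} → k ≤ n → (n C k) * (k ! * (n ∸ k) !) ≡ n !
  binomial-factorials {n} {k} k≤n = begin
    (n C k) * (k ! * (n ∸ k) !)          ≡⟨ cong (_* (k ! * (n ∸ k) !)) (nCk≡n!/k![n-k]! k≤n) ⟩
    n ! / (k ! * (n ∸ k) !) * (k ! * (n ∸ k) !) ≡⟨ m/n*n≡m (k![n∸k]!∣n! k≤n) ⟩
    n ! ∎
    where instance _ = k !* (n ∸ k) !≢0

  binomial-ratio : ∀ n k → (n C k) * (n ∸ k) ≡ (n C suc k) * suc k
  binomial-ratio n k with <-cmp k n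
  ... | tri> _ _ k>n = begin
    (n C k) * (n ∸ k)  ≡⟨ cong (_* (n ∸ k)) (k>n⇒nCk≡0 k>n) ⟩
    0                  ≡⟨ cong (_* suc k) (k>n⇒nCk≡0 (m<n⇒m<1+n k>n)) ⟨
    (n C suc k) * suc k ∎
  ... | tri≈ _ refl _ = begin
    (n C n) * (n ∸ n)  ≡⟨ cong ((n C n) *_) (n∸n≡0 n) ⟩
    (n C n) * 0        ≡⟨ *-zeroʳ (n C n) ⟩
    0                  ≡⟨ cong (_* suc n) (k>n⇒nCk≡0 (n<1+n n)) ⟨
    (n C suc n) * suc n ∎
  ... | tri< k<n _ _ = *-cancelʳ-≡ _ _ (suc k ! * (n ∸ suc k) !) {{suc k !* (n ∸ suc k) !≢0}} (begin
    (n C k) * (n ∸ k) * d′          ≡⟨ *-assoc (n C k) (n ∸ k) d′ ⟩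
    (n C k) * ((n ∸ k) * d′)        ≡⟨ cong ((n C k) *_) ([n-k]*d[k+1]≡[k+1]*d[k] k<n) ⟩
    (n C k) * (suc k * d)           ≡⟨ x*[y*z]≡y*[x*z] (n C k) (suc k) d ⟩
    suc k * ((n C k) * d)           ≡⟨ cong (suc k *_) (binomial-factorials (<⇒≤ k<n)) ⟩
    suc k * n !                     ≡⟨ cong (suc k *_) (binomial-factorials k<n) ⟨
    suc k * ((n C suc k) * d′)      ≡⟨ x*[y*z]≡y*[x*z] (suc k) (n C suc k) d′ ⟩
    (n C suc k) * (suc k * d′)      ≡⟨ *-assoc (n C suc k) (suc k) d′ ⟨
    (n C suc k) * suc k * d′ ∎)
    where
    d d′ : ℕ
    d  = k ! * (n ∸ k) !
    d′ = suc k ! * (n ∸ suc k) !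
    x*[y*z]≡y*[x*z] : ∀ x y z → x * (y * z) ≡ y * (x * z)
    x*[y*z]≡y*[x*z] = solve-∀

  central : ℕ → ℕ
  central i = (i + i) C i

  central-ratio : ∀ i → central i * i ≡ ((i + i) C suc i) * suc i
  central-ratio i = trans (cong (central i *_) (sym (m+n∸n≡m i i))) (binomial-ratio (i + i) i)

  catalan-central : ∀ i → catalan i * suc i ≡ central i
  catalan-central i = begin
    catalan i * suc i       ≡⟨ cong (λ x → x / suc i * suc i) central≡ ⟩
    (b ∸ e) * suc i / suc i * suc i ≡⟨ cong (_* suc i) (m*n/n≡m (b ∸ e) (suc i)) ⟩
    (b ∸ e) * suc i         ≡⟨ central≡ ⟨
    b ∎
    where
    b e : ℕ
    b = central i
    e = (i + i) C suc i
    central≡ : b ≡ (b ∸ e) * suc i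
    central≡ = sym (begin
      (b ∸ e) * suc i           ≡⟨ *-distribʳ-∸ (suc i) b e ⟩
      b * suc i ∸ e * suc i     ≡⟨ cong (_∸ e * suc i) (trans (*-suc b i) (cong (b +_) (central-ratio i))) ⟩
      b + e * suc i ∸ e * suc i ≡⟨ m+n∸n≡m b (e * suc i) ⟩
      b ∎)

  central-step : ∀ i → suc i * central (suc i) ≡ 2 * suc (i + i) * central i
  central-step i = begin
    suc i * central (suc i)               ≡⟨ cong (λ m → suc i * (m C suc i)) (+-suc (suc i) i) ⟩
    suc i * (suc (suc (i + i)) C suc i)   ≡⟨ cong (suc i *_) (sym (nCk+nC[k+1]≡[n+1]C[k+1] (suc (i + i)) i)) ⟩
    suc i * (m C i + m C suc i)           ≡⟨ cong (λ x → suc i * (x + m C suc i)) symmetry ⟩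
    suc i * (m C suc i + m C suc i)       ≡⟨ cong (λ x → suc i * (x + x)) (sym (nCk+nC[k+1]≡[n+1]C[k+1] (i + i) i)) ⟩
    suc i * ((b + e) + (b + e))           ≡⟨ expand i b e ⟩
    2 * (suc i * b) + 2 * (e * suc i)     ≡⟨ cong (λ x → 2 * (suc i * b) + 2 * x) (sym (central-ratio i)) ⟩
    2 * (suc i * b) + 2 * (b * i)         ≡⟨ collect i b ⟩
    2 * suc (i + i) * b ∎
    where
    m b e : ℕ
    m = suc (i + i)
    b = central i
    e = (i + i) C suc i
    symmetry : m C i ≡ m C suc i
    symmetry = trans (nCk≡nC[n∸k] (m≤n+m i (suc i))) (cong (m C_) (m+n∸n≡m (suc i) i))
    expand : ∀ i b e → suc i * ((b + e) + (b + e)) ≡ 2 * (suc i * b) + 2 * (e * suc i)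
    expand = solve-∀
    collect : ∀ i b → 2 * (suc i * b) + 2 * (b * i) ≡ 2 * suc (i + i) * b
    collect = solve-∀

  catalan-step : ∀ i → suc (suc i) * catalan (suc i) ≡ 2 * suc (i + i) * catalan i
  catalan-step i = *-cancelʳ-≡ _ _ (suc i) (begin
    suc (suc i) * catalan (suc i) * suc i     ≡⟨ swap (suc (suc i)) (catalan (suc i)) (suc i) ⟩
    suc i * (catalan (suc i) * suc (suc i))   ≡⟨ cong (suc i *_) (catalan-central (suc i)) ⟩
    suc i * central (suc i)                   ≡⟨ central-step i ⟩
    2 * suc (i + i) * central i               ≡⟨ cong (2 * suc (i + i) *_) (catalan-central i) ⟨
    2 * suc (i + i) * (catalan i * suc i)     ≡⟨ *-assoc (2 * suc (i + i)) (catalan i) (suc i) ⟨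
    2 * suc (i + i) * catalan i * suc i ∎)
    where
    swap : ∀ x y z → x * y * z ≡ z * (y * x)
    swap = solve-∀

  sumℕ : ℕ → (ℕ → ℕ) → ℕ
  sumℕ zero    f = 0
  sumℕ (suc n) f = sumℕ n f + f n

  sumℕ-*ˡ : ∀ a n f → sumℕ n (λ i → a * f i) ≡ a * sumℕ n f
  sumℕ-*ˡ a zero    f = sym (*-zeroʳ a)
  sumℕ-*ˡ a (suc n) f = trans (cong (_+ a * f n) (sumℕ-*ˡ a n f)) (sym (*-distribˡ-+ a (sumℕ n f) (f n)))

  telescope : (P Q T : ℕ → ℕ) → ∀ k →
              (∀ i → i < k → P (suc i) + Q i ≡ T i + Q (suc i) + P i) →
              sumℕ k T + Q k + P 0 ≡ P k + Q 0
  telescope P Q T zero    step = +-comm (Q 0) (P 0)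
  telescope P Q T (suc k) step = +-cancelʳ-≡ (P k) _ _ (begin
    S + T k + Q (suc k) + P 0 + P k       ≡⟨ regroup₁ S (T k) (Q (suc k)) (P 0) (P k) ⟩
    S + P 0 + (T k + Q (suc k) + P k)     ≡⟨ cong (S + P 0 +_) (step k ≤-refl) ⟨
    S + P 0 + (P (suc k) + Q k)           ≡⟨ regroup₂ S (P 0) (P (suc k)) (Q k) ⟩
    (S + Q k + P 0) + P (suc k)           ≡⟨ cong (_+ P (suc k)) (telescope P Q T k (λ i i<k → step i (m<n⇒m<1+n i<k))) ⟩
    P k + Q 0 + P (suc k)                 ≡⟨ regroup₃ (P k) (Q 0) (P (suc k)) ⟩
    P (suc k) + Q 0 + P k ∎)
    where
    S : ℕ
    S = sumℕ k T
    regroup₁ : ∀ s t q p₀ p → s + t + q + p₀ + p ≡ s + p₀ + (t + q + p)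
    regroup₁ = solve-∀
    regroup₂ : ∀ s p₀ p′ q → s + p₀ + (p′ + q) ≡ (s + q + p₀) + p′
    regroup₂ = solve-∀
    regroup₃ : ∀ p q₀ p′ → p + q₀ + p′ ≡ p′ + q₀ + p
    regroup₃ = solve-∀

  -- Ingredients of the telescoping proof of the Catalan convolution, for a fixed m = n + 1:
  -- with  w(k) = (k+1)C_k · (m-k+1)C_{m-k},  the potentials are  P(k) = 2k·w(k)  and  Q(k) = m·w(k).
  scaledCatalan : ℕ → ℕ
  scaledCatalan k = suc k * catalan k

  weight : ℕ → ℕ → ℕ
  weight m k = scaledCatalan k * scaledCatalan (m ∸ k)

  potentialP potentialQ : ℕ → ℕ → ℕ
  potentialP m k = weight m k * (2 * k)
  potentialQ m k = weight m k * m

  convolutionTerm : ℕ → ℕ → ℕ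
  convolutionTerm n i = 2 * suc n * suc (suc n) * (catalan i * catalan (n ∸ i))

  TelescopeStep : ℕ → ℕ → Set
  TelescopeStep n i = potentialP (suc n) (suc i) + potentialQ (suc n) i
                    ≡ convolutionTerm n i + potentialQ (suc n) (suc i) + potentialP (suc n) i

  -- Each step of the telescope is the ratio recurrence applied at i and at j = n - i.
  telescope-step : ∀ i j → TelescopeStep (i + j) i
  telescope-step i j = begin
    weight m (suc i) * (2 * suc i) + weight m i * m
      ≡⟨ cong₂ (λ a b → a * (2 * suc i) + b * m) weight-suc weight-i ⟩
    A * (2 * suc i) + B * m
      ≡⟨ identity i j (catalan i) (catalan j) ⟩
    2 * m * suc m * (catalan i * catalan j) + A * m + B * (2 * i)
      ≡⟨ cong (λ k → 2 * m * suc m * (catalan i * catalan k) + A * m + B * (2 * i)) (m+n∸m≡n i j) ⟨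
    convolutionTerm (i + j) i + A * m + B * (2 * i)
      ≡⟨ cong₂ (λ a b → convolutionTerm (i + j) i + a * m + b * (2 * i)) weight-suc weight-i ⟨
    convolutionTerm (i + j) i + weight m (suc i) * m + weight m i * (2 * i) ∎
    where
    m A B : ℕ
    m = suc (i + j)
    A = 2 * suc (i + i) * catalan i * (suc j * catalan j)
    B = suc i * catalan i * (2 * suc (j + j) * catalan j)
    weight-suc : weight m (suc i) ≡ A
    weight-suc = cong₂ (λ a b → a * (suc b * catalan b)) (catalan-step i) (m+n∸m≡n i j)
    weight-i : weight m i ≡ B
    weight-i = begin
      scaledCatalan i * scaledCatalan (m ∸ i) ≡⟨ cong (λ k → scaledCatalan i * scaledCatalan k)
                                                      (trans (+-∸-assoc 1 (m≤m+n i j)) (cong suc (m+n∸m≡n i j))) ⟩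
      scaledCatalan i * scaledCatalan (suc j) ≡⟨ cong (scaledCatalan i *_) (catalan-step j) ⟩
      B ∎
    identity : ∀ i j x y →
      2 * suc (i + i) * x * (suc j * y) * (2 * suc i) + suc i * x * (2 * suc (j + j) * y) * suc (i + j)
      ≡ 2 * suc (i + j) * suc (suc (i + j)) * (x * y) + 2 * suc (i + i) * x * (suc j * y) * suc (i + j)
        + suc i * x * (2 * suc (j + j) * y) * (2 * i)
    identity = solve-∀

  catalan-convolution : ∀ n → catalan (suc n) ≡ sumℕ (suc n) (λ i → catalan i * catalan (n ∸ i))
  catalan-convolution n = *-cancelˡ-≡ _ _ (2 * m * suc m) (begin
    2 * m * suc m * catalan m          ≡⟨ rearrange m (catalan m) ⟩
    X * (2 * m)                        ≡⟨ +-cancelʳ-≡ (X * m) _ _ telescoped ⟨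
    sumℕ m (convolutionTerm n)         ≡⟨ sumℕ-*ˡ (2 * m * suc m) m (λ i → catalan i * catalan (n ∸ i)) ⟩
    2 * m * suc m * sumℕ m (λ i → catalan i * catalan (n ∸ i)) ∎)
    where
    m X : ℕ
    m = suc n
    X = scaledCatalan m
    rearrange : ∀ m c → 2 * m * suc m * c ≡ suc m * c * (2 * m)
    rearrange = solve-∀
    weight-end : weight m m ≡ X
    weight-end = trans (cong (λ k → X * scaledCatalan k) (n∸n≡0 n)) (*-identityʳ X)
    telescoped : sumℕ m (convolutionTerm n) + X * m ≡ X * (2 * m) + X * m
    telescoped = begin
      sumℕ m (convolutionTerm n) + X * m
        ≡⟨ +-identityʳ _ ⟨
      sumℕ m (convolutionTerm n) + X * m + 0
        ≡⟨ cong₂ (λ a b → sumℕ m (convolutionTerm n) + a * m + b) weight-end (*-zeroʳ (weight m 0)) ⟨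
      sumℕ m (convolutionTerm n) + potentialQ m m + potentialP m 0
        ≡⟨ telescope (potentialP m) (potentialQ m) (convolutionTerm n) m
             (λ i i<m → subst (λ k → TelescopeStep k i) (m+[n∸m]≡n (≤-pred i<m)) (telescope-step i (n ∸ i))) ⟩
      potentialP m m + potentialQ m 0
        ≡⟨ cong₂ (λ a b → a * (2 * m) + b * m) weight-end (*-identityˡ X) ⟩
      X * (2 * m) + X * m ∎

-- Every commutative ring receives the canonical map from ℤ, which is a ring
-- homomorphism; hence the ring solver with integer coefficients applies to it.
module IntegerRingSolver {c ℓ : Level} (R : CommutativeRing c ℓ) where
  open import Data.Nat as ℕ using (zero)
  import Data.Nat.Properties as ℕ
  open import Data.Integer as ℤ using (ℤ; +_; -[1+_]; _⊖_; +-*-rawRing)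
  import Data.Integer.Properties as ℤ
  open import Data.Maybe using (Maybe; just; nothing)
  open import Relation.Nullary using (yes; no)
  import Relation.Binary.PropositionalEquality as ≡
  open import Algebra.Solver.Ring.AlmostCommutativeRing
    using (_-Raw-AlmostCommutative⟶_; fromCommutativeRing)
  open CommutativeRing R
  open import Algebra.Properties.CommutativeSemigroup +-commutativeSemigroup using ()
    renaming (interchange to +-interchange)
  open import Algebra.Properties.Ring ring using (-0#≈0#; -‿+-comm; -‿involutive; -‿distribˡ-*; -‿distribʳ-*)
  open import Algebra.Properties.Semiring.Mult.TCOptimised semiring using (_×_; ×-homo-+; ×1-homo-*)
  open import Relation.Binary.Reasoning.Setoid setoid

  -- The image of an integer; _×_ is the library's optimised multiple, for which 1 × 1# is 1#.
  integer : ℤ → Carrier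
  integer (+ n)    = n × 1#
  integer -[1+ n ] = - (suc n × 1#)

  ×-suc : ∀ m → suc m × 1# ≈ 1# + m × 1#
  ×-suc m = ×-homo-+ 1# 1 m

  -- The homomorphism laws; ℤ's addition of mixed signs goes through _⊖_.
  integer-⊖ : ∀ m n → integer (m ⊖ n) ≈ m × 1# - n × 1#
  integer-⊖ zero    zero    = sym (-‿inverseʳ 0#)
  integer-⊖ zero    (suc n) = sym (+-identityˡ _)
  integer-⊖ (suc m) zero    = sym (trans (+-congˡ -0#≈0#) (+-identityʳ _))
  integer-⊖ (suc m) (suc n) = begin
    integer (suc m ⊖ suc n)               ≡⟨ ≡.cong integer (ℤ.[1+m]⊖[1+n]≡m⊖n m n) ⟩
    integer (m ⊖ n)                       ≈⟨ integer-⊖ m n ⟩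
    m × 1# - n × 1#                       ≈⟨ +-identityˡ _ ⟨
    0# + (m × 1# - n × 1#)                ≈⟨ +-congʳ (-‿inverseʳ 1#) ⟨
    (1# - 1#) + (m × 1# - n × 1#)         ≈⟨ +-interchange 1# (- 1#) (m × 1#) (- (n × 1#)) ⟩
    (1# + m × 1#) + (- 1# - n × 1#)       ≈⟨ +-cong (×-suc m) (trans (-‿cong (×-suc n)) (sym (-‿+-comm 1# (n × 1#)))) ⟨
    suc m × 1# - suc n × 1# ∎

  integer-neg : ∀ x → integer (ℤ.- x) ≈ - integer x
  integer-neg -[1+ n ]    = sym (-‿involutive _)
  integer-neg (+ zero)    = sym -0#≈0#
  integer-neg (+ (suc n)) = refl

  integer-+ : ∀ x y → integer (x ℤ.+ y) ≈ integer x + integer y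
  integer-+ (+ m)    (+ n)    = ×-homo-+ 1# m n
  integer-+ (+ m)    -[1+ n ] = integer-⊖ m (suc n)
  integer-+ -[1+ m ] (+ n)    = trans (integer-⊖ n (suc m)) (+-comm _ _)
  integer-+ -[1+ m ] -[1+ n ] = begin
    - (suc (suc (m ℕ.+ n)) × 1#)      ≡⟨ ≡.cong (λ k → - (k × 1#)) (≡.sym (ℕ.+-suc (suc m) n)) ⟩
    - ((suc m ℕ.+ suc n) × 1#)        ≈⟨ -‿cong (×-homo-+ 1# (suc m) (suc n)) ⟩
    - (suc m × 1# + suc n × 1#)       ≈⟨ -‿+-comm _ _ ⟨
    - (suc m × 1#) + - (suc n × 1#) ∎

  integer-* : ∀ x y → integer (x ℤ.* y) ≈ integer x * integer y
  integer-* (+ m) (+ n) = begin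
    integer (+ m ℤ.* + n)         ≡⟨ ≡.cong integer (ℤ.+◃n≡+n (m ℕ.* n)) ⟩
    (m ℕ.* n) × 1#                ≈⟨ ×1-homo-* m n ⟩
    m × 1# * n × 1# ∎
  integer-* (+ m) -[1+ n ] = begin
    integer (+ m ℤ.* -[1+ n ])    ≡⟨ ≡.cong integer (ℤ.-◃n≡-n (m ℕ.* suc n)) ⟩
    integer (ℤ.- + (m ℕ.* suc n)) ≈⟨ integer-neg (+ (m ℕ.* suc n)) ⟩
    - ((m ℕ.* suc n) × 1#)        ≈⟨ -‿cong (×1-homo-* m (suc n)) ⟩
    - (m × 1# * suc n × 1#)       ≈⟨ -‿distribʳ-* _ _ ⟩
    m × 1# * - (suc n × 1#) ∎
  integer-* -[1+ m ] (+ n) = begin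
    integer (-[1+ m ] ℤ.* + n)    ≡⟨ ≡.cong integer (ℤ.-◃n≡-n (suc m ℕ.* n)) ⟩
    integer (ℤ.- + (suc m ℕ.* n)) ≈⟨ integer-neg (+ (suc m ℕ.* n)) ⟩
    - ((suc m ℕ.* n) × 1#)        ≈⟨ -‿cong (×1-homo-* (suc m) n) ⟩
    - (suc m × 1# * n × 1#)       ≈⟨ -‿distribˡ-* _ _ ⟩
    - (suc m × 1#) * n × 1# ∎
  integer-* -[1+ m ] -[1+ n ] = begin
    integer (-[1+ m ] ℤ.* -[1+ n ])    ≡⟨ ≡.cong integer (ℤ.+◃n≡+n (suc m ℕ.* suc n)) ⟩
    (suc m ℕ.* suc n) × 1#             ≈⟨ ×1-homo-* (suc m) (suc n) ⟩
    a * b                              ≈⟨ -‿involutive _ ⟨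
    - - (a * b)                        ≈⟨ -‿cong (-‿distribˡ-* a b) ⟩
    - (- a * b)                        ≈⟨ -‿distribʳ-* (- a) b ⟩
    - a * - b ∎
    where
    a b : Carrier
    a = suc m × 1#
    b = suc n × 1#

  integerHomomorphism : +-*-rawRing -Raw-AlmostCommutative⟶ fromCommutativeRing R
  integerHomomorphism = record
    { ⟦_⟧    = integer
    ; +-homo = integer-+
    ; *-homo = integer-*
    ; -‿homo = integer-neg
    ; 0-homo = refl
    ; 1-homo = refl
    }

  -- Equal integer coefficients have equal images (the solver only needs this soundness).
  coefficient-equality : ∀ a b → Maybe (integer a ≈ integer b)
  coefficient-equality a b with a ℤ.≟ b
  ... | yes ≡.refl = just refl
  ... | no _       = nothing

  open import Algebra.Solver.Ring +-*-rawRing (fromCommutativeRing R) integerHomomorphism coefficient-equality public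

module FormalPowerSeries {c ℓ : Level} (R : CommutativeRing c ℓ) where
  open import Data.Nat as ℕ using (zero; _∸_; _≤_; _<_; _≤′_; ≤′-refl; ≤′-step; s≤s)
  import Data.Nat.Properties as ℕ
  open import Data.Product using (_,_)
  open import Relation.Nullary using (yes; no)
  import Relation.Binary.PropositionalEquality as ≡
  open import Algebra.Structures using (IsCommutativeRing)
  open CatalanNumbers using (sumℕ; catalan-convolution)
  open CommutativeRing R
  open PowerSeries R
  open import Relation.Binary.Reasoning.Setoid setoid
  open import Algebra.Properties.Semiring.Mult.TCOptimised semiring using (_×_; ×-homo-+; ×1-homo-*)
  open import Algebra.Properties.CommutativeSemigroup +-commutativeSemigroup using ()
    renaming (interchange to +-interchange)
  open import Algebra.Properties.CommutativeSemigroup *-commutativeSemigroup using (x∙yz≈y∙xz)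
    renaming (interchange to *-interchange)

  sum-cong : ∀ n {f g : ℕ → Carrier} → (∀ i → i < n → f i ≈ g i) → sumTo n f ≈ sumTo n g
  sum-cong zero    f≈g = refl
  sum-cong (suc n) f≈g = +-cong (sum-cong n (λ i i<n → f≈g i (ℕ.m<n⇒m<1+n i<n))) (f≈g n ℕ.≤-refl)

  sum-cong′ : ∀ n {f g : ℕ → Carrier} → (∀ i → f i ≈ g i) → sumTo n f ≈ sumTo n g
  sum-cong′ n f≈g = sum-cong n (λ i _ → f≈g i)

  sum-+ : ∀ n (f g : ℕ → Carrier) → sumTo n (λ i → f i + g i) ≈ sumTo n f + sumTo n g
  sum-+ zero    f g = sym (+-identityˡ 0#)
  sum-+ (suc n) f g = trans (+-congʳ (sum-+ n f g)) (+-interchange _ _ _ _)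

  sum-*ˡ : ∀ n a (f : ℕ → Carrier) → sumTo n (λ i → a * f i) ≈ a * sumTo n f
  sum-*ˡ zero    a f = sym (zeroʳ a)
  sum-*ˡ (suc n) a f = trans (+-congʳ (sum-*ˡ n a f)) (sym (distribˡ a _ _))

  sum-*ʳ : ∀ n a (f : ℕ → Carrier) → sumTo n (λ i → f i * a) ≈ sumTo n f * a
  sum-*ʳ n a f = trans (sum-cong′ n (λ i → *-comm (f i) a)) (trans (sum-*ˡ n a f) (*-comm a _))

  sum-zero : ∀ n (f : ℕ → Carrier) → (∀ i → i < n → f i ≈ 0#) → sumTo n f ≈ 0#
  sum-zero zero    f f≈0 = refl
  sum-zero (suc n) f f≈0 =
    trans (+-cong (sum-zero n f (λ i i<n → f≈0 i (ℕ.m<n⇒m<1+n i<n))) (f≈0 n ℕ.≤-refl)) (+-identityʳ 0#)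

  sum-head : ∀ n (f : ℕ → Carrier) → sumTo (suc n) f ≈ f 0 + sumTo n (λ i → f (suc i))
  sum-head zero    f = trans (+-identityˡ _) (sym (+-identityʳ _))
  sum-head (suc n) f = trans (+-congʳ (sum-head n f)) (+-assoc _ _ _)

  sum-pad : ∀ {m n} (f : ℕ → Carrier) → m ≤ n → (∀ i → m ≤ i → f i ≈ 0#) → sumTo n f ≈ sumTo m f
  sum-pad {m} f m≤n f≈0 = go (ℕ.≤⇒≤′ m≤n)
    where
    go : ∀ {n} → m ≤′ n → sumTo n f ≈ sumTo m f
    go ≤′-refl      = refl
    go (≤′-step {n} m≤′n) = trans (+-cong (go m≤′n) (f≈0 n (ℕ.≤′⇒≤ m≤′n))) (+-identityʳ _)

  sum-reverse : ∀ n (f : ℕ → Carrier) → sumTo (suc n) f ≈ sumTo (suc n) (λ i → f (n ∸ i))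
  sum-reverse zero    f = refl
  sum-reverse (suc n) f = begin
    sumTo (suc n) f + f (suc n)                     ≈⟨ +-comm _ _ ⟩
    f (suc n) + sumTo (suc n) f                     ≈⟨ +-congˡ (sum-reverse n f) ⟩
    f (suc n) + sumTo (suc n) (λ i → f (n ∸ i))     ≈⟨ sum-head (suc n) (λ i → f (suc n ∸ i)) ⟨
    sumTo (suc (suc n)) (λ i → f (suc n ∸ i)) ∎

  sum-swap : ∀ m n (f : ℕ → ℕ → Carrier) →
             sumTo m (λ i → sumTo n (f i)) ≈ sumTo n (λ j → sumTo m (λ i → f i j))
  sum-swap zero    n f = sym (sum-zero n (λ _ → 0#) (λ _ _ → refl))
  sum-swap (suc m) n f = trans (+-congʳ (sum-swap m n f)) (sym (sum-+ n (λ j → sumTo m (λ i → f i j)) (f m)))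

  sum-triangle : ∀ N (F : ℕ → ℕ → Carrier) →
                 sumTo N (λ i → sumTo (N ∸ i) (F i)) ≈ sumTo N (λ k → sumTo (suc k) (λ i → F i (k ∸ i)))
  sum-triangle zero    F = refl
  sum-triangle (suc N) F = begin
    sumTo (suc N) (λ i → sumTo (suc N ∸ i) (F i))
      ≈⟨ sum-head N _ ⟩
    sumTo (suc N) (F 0) + sumTo N (λ i → sumTo (N ∸ i) (F (suc i)))
      ≈⟨ +-congˡ (sum-triangle N (λ i → F (suc i))) ⟩
    sumTo (suc N) (F 0) + sumTo N (λ k → sumTo (suc k) (λ i → F (suc i) (k ∸ i)))
      ≈⟨ +-congˡ (+-identityˡ _) ⟨
    sumTo (suc N) (F 0) + (0# + sumTo N (λ k → sumTo (suc k) (λ i → F (suc i) (k ∸ i))))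
      ≈⟨ +-congˡ (sum-head N _) ⟨
    sumTo (suc N) (F 0) + sumTo (suc N) (λ k → sumTo k (λ i → F (suc i) (k ∸ suc i)))
      ≈⟨ sum-+ (suc N) _ _ ⟨
    sumTo (suc N) (λ k → F 0 k + sumTo k (λ i → F (suc i) (k ∸ suc i)))
      ≈⟨ sum-cong′ (suc N) (λ k → sum-head k (λ i → F i (k ∸ i))) ⟨
    sumTo (suc N) (λ k → sumTo (suc k) (λ i → F i (k ∸ i))) ∎

  infix 4 _≋_
  _≋_ : PS → PS → Set ℓ
  f ≋ g = ∀ n → f n ≈ g n

  infixl 6 _⊕_
  _⊕_ : PS → PS → PS
  (f ⊕ g) n = f n + g n

  ⊝_ : PS → PS
  (⊝ f) n = - f n

  zeroS : PS
  zeroS _ = 0#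

  ≋-refl : ∀ {f} → f ≋ f
  ≋-refl n = refl

  ≋-sym : ∀ {f g} → f ≋ g → g ≋ f
  ≋-sym f≋g n = sym (f≋g n)

  infixr 1 _⟫_
  _⟫_ : ∀ {f g h} → f ≋ g → g ≋ h → f ≋ h
  (f≋g ⟫ g≋h) n = trans (f≋g n) (g≋h n)

  ⊛-cong : ∀ {f f′ g g′} → f ≋ f′ → g ≋ g′ → f ⊛ g ≋ f′ ⊛ g′
  ⊛-cong f≋f′ g≋g′ n = sum-cong′ (suc n) (λ i → *-cong (f≋f′ i) (g≋g′ (n ∸ i)))

  ⊛-comm : ∀ f g → f ⊛ g ≋ g ⊛ f
  ⊛-comm f g n = trans (sum-reverse n _) (sum-cong (suc n) λ i i<1+n →
    trans (*-comm _ _) (*-congʳ (reflexive (≡.cong g (ℕ.m∸[m∸n]≡n (ℕ.≤-pred i<1+n))))))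

  ⊛-identityˡ : ∀ f → oneS ⊛ f ≋ f
  ⊛-identityˡ f n = begin
    (oneS ⊛ f) n                                      ≈⟨ sum-head n _ ⟩
    1# * f n + sumTo n (λ i → 0# * f (n ∸ suc i))     ≈⟨ +-cong (*-identityˡ _) (sum-zero n _ (λ i _ → zeroˡ _)) ⟩
    f n + 0#                                          ≈⟨ +-identityʳ _ ⟩
    f n ∎

  ⊛-identityʳ : ∀ f → f ⊛ oneS ≋ f
  ⊛-identityʳ f = ⊛-comm f oneS ⟫ ⊛-identityˡ f

  ⊛-distribˡ : ∀ f g h → f ⊛ (g ⊕ h) ≋ (f ⊛ g) ⊕ (f ⊛ h)
  ⊛-distribˡ f g h n = trans (sum-cong′ (suc n) (λ i → distribˡ _ _ _)) (sum-+ (suc n) _ _)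

  ⊛-distribʳ : ∀ f g h → (g ⊕ h) ⊛ f ≋ (g ⊛ f) ⊕ (h ⊛ f)
  ⊛-distribʳ f g h = ⊛-comm (g ⊕ h) f ⟫ ⊛-distribˡ f g h ⟫ λ n → +-cong (⊛-comm f g n) (⊛-comm f h n)

  -- Both sides are the sum of f i g j h k over i + j + k = n.
  ⊛-assoc : ∀ f g h → (f ⊛ g) ⊛ h ≋ f ⊛ (g ⊛ h)
  ⊛-assoc f g h n = begin
    ((f ⊛ g) ⊛ h) n
      ≈⟨ sum-cong′ (suc n) (λ k → sym (sum-*ʳ (suc k) (h (n ∸ k)) _)) ⟩
    sumTo (suc n) (λ k → sumTo (suc k) (λ i → f i * g (k ∸ i) * h (n ∸ k)))
      ≈⟨ sum-cong′ (suc n) (λ k → sum-cong (suc k) (λ i i<1+k →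
           *-congˡ (reflexive (≡.cong (λ j → h (n ∸ j)) (≡.sym (ℕ.m+[n∸m]≡n (ℕ.≤-pred i<1+k))))))) ⟩
    sumTo (suc n) (λ k → sumTo (suc k) (λ i → F i (k ∸ i)))
      ≈⟨ sum-triangle (suc n) F ⟨
    sumTo (suc n) (λ i → sumTo (suc n ∸ i) (F i))
      ≈⟨ sum-cong (suc n) (λ i i<1+n → reflexive (≡.cong (λ m → sumTo m (F i)) (ℕ.+-∸-assoc 1 (ℕ.≤-pred i<1+n)))) ⟩
    sumTo (suc n) (λ i → sumTo (suc (n ∸ i)) (F i))
      ≈⟨ sum-cong′ (suc n) (λ i → trans (sum-cong′ (suc (n ∸ i)) (λ j → trans (*-assoc _ _ _)
           (*-congˡ (*-congˡ (reflexive (≡.cong h (≡.sym (ℕ.∸-+-assoc n i j)))))))) (sum-*ˡ (suc (n ∸ i)) (f i) _)) ⟩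
    (f ⊛ (g ⊛ h)) n ∎
    where
    F : ℕ → ℕ → Carrier
    F i j = f i * g j * h (n ∸ (i ℕ.+ j))

  -- Power series form a commutative ring; this lets the ring solver manipulate series.
  series-isCommutativeRing : IsCommutativeRing _≋_ _⊕_ _⊛_ ⊝_ zeroS oneS
  series-isCommutativeRing = record
    { isRing = record
      { +-isAbelianGroup = record
        { isGroup = record
          { isMonoid = record
            { isSemigroup = record
              { isMagma = record
                { isEquivalence = record { refl = ≋-refl ; sym = ≋-sym ; trans = _⟫_ }
                ; ∙-cong = λ f≋f′ g≋g′ n → +-cong (f≋f′ n) (g≋g′ n) }
              ; assoc = λ f g h n → +-assoc (f n) (g n) (h n) }
            ; identity = (λ f n → +-identityˡ (f n)) , (λ f n → +-identityʳ (f n)) }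
          ; inverse = (λ f n → -‿inverseˡ (f n)) , (λ f n → -‿inverseʳ (f n))
          ; ⁻¹-cong = λ f≋g n → -‿cong (f≋g n) }
        ; comm = λ f g n → +-comm (f n) (g n) }
      ; *-cong = ⊛-cong
      ; *-assoc = ⊛-assoc
      ; *-identity = ⊛-identityˡ , ⊛-identityʳ
      ; distrib = ⊛-distribˡ , ⊛-distribʳ }
    ; *-comm = ⊛-comm }

  seriesRing : CommutativeRing c ℓ
  seriesRing = record { isCommutativeRing = series-isCommutativeRing }

  module SeriesSolver = IntegerRingSolver seriesRing
  module CoefficientSolver = IntegerRingSolver R

  VanishesBelow : ℕ → PS → Set ℓ
  VanishesBelow k f = ∀ n → n < k → f n ≈ 0#

  vanishes-cong : ∀ {k f g} → f ≋ g → VanishesBelow k g → VanishesBelow k f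
  vanishes-cong f≋g g≈0 n n<k = trans (f≋g n) (g≈0 n n<k)

  ⊛-vanishes : ∀ a b {f g} → VanishesBelow a f → VanishesBelow b g → VanishesBelow (a ℕ.+ b) (f ⊛ g)
  ⊛-vanishes a b {f} {g} f≈0 g≈0 n n<a+b = sum-zero (suc n) _ λ i i<1+n → term i (ℕ.≤-pred i<1+n)
    where
    term : ∀ i → i ≤ n → f i * g (n ∸ i) ≈ 0#
    term i i≤n with i ℕ.<? a
    ... | yes i<a = trans (*-congʳ (f≈0 i i<a)) (zeroˡ _)
    ... | no  i≮a = trans (*-congˡ (g≈0 (n ∸ i) n∸i<b)) (zeroʳ _)
      where
      n∸i<b : n ∸ i < b
      n∸i<b = ℕ.<-≤-trans (ℕ.∸-monoˡ-< n<a+b i≤n)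
                (ℕ.≤-trans (ℕ.∸-monoʳ-≤ (a ℕ.+ b) (ℕ.≮⇒≥ i≮a)) (ℕ.≤-reflexive (ℕ.m+n∸m≡n a b)))

  ⊛-vanishesˡ : ∀ {k f} g → VanishesBelow k f → VanishesBelow k (f ⊛ g)
  ⊛-vanishesˡ {k} g f≈0 = ≡.subst (λ m → VanishesBelow m _) (ℕ.+-identityʳ k) (⊛-vanishes k 0 {g = g} f≈0 (λ _ ()))

  pow-vanishes : ∀ {y} → y 0 ≈ 0# → ∀ k → VanishesBelow k (pow y k)
  pow-vanishes y0≈0 zero    n ()
  pow-vanishes {y} y0≈0 (suc k) = ⊛-vanishes 1 k y-vanishes (pow-vanishes y0≈0 k)
    where
    y-vanishes : VanishesBelow 1 y
    y-vanishes zero    _         = y0≈0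
    y-vanishes (suc n) (s≤s ())

  pow-+ : ∀ y i j → pow y (i ℕ.+ j) ≋ pow y i ⊛ pow y j
  pow-+ y zero    j = ≋-sym (⊛-identityˡ (pow y j))
  pow-+ y (suc i) j = ⊛-cong {y} ≋-refl (pow-+ y i j) ⟫ ≋-sym (⊛-assoc y (pow y i) (pow y j))

  -- Sums of families F with F k = O(x^k): only finitely many terms affect each coefficient.

  Summable : (ℕ → PS) → Set ℓ
  Summable F = ∀ k → VanishesBelow k (F k)

  Σ∞ : (ℕ → PS) → PS
  Σ∞ F n = sumTo (suc n) (λ k → F k n)

  Σ∞-cong : ∀ {F G} → (∀ k → F k ≋ G k) → Σ∞ F ≋ Σ∞ G
  Σ∞-cong F≋G n = sum-cong′ (suc n) (λ k → F≋G k n)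

  Σ∞-truncate : ∀ F → Summable F → ∀ n N → n < N → sumTo N (λ k → F k n) ≈ Σ∞ F n
  Σ∞-truncate F summable n N n<N = sum-pad _ n<N (λ k n<k → summable k n n<k)

  Σ∞-head : ∀ F → Summable F → Σ∞ F ≋ F 0 ⊕ Σ∞ (λ k → F (suc k))
  Σ∞-head F summable n =
    trans (sum-head n _) (+-congˡ (sym (trans (+-congˡ (summable (suc n) n ℕ.≤-refl)) (+-identityʳ _))))

  Σ∞-⊛ : ∀ F X → Summable F → Σ∞ F ⊛ X ≋ Σ∞ (λ k → F k ⊛ X)
  Σ∞-⊛ F X summable n = begin
    (Σ∞ F ⊛ X) n
      ≈⟨ sum-cong (suc n) (λ m m<1+n → *-congʳ (sym (Σ∞-truncate F summable m (suc n) m<1+n))) ⟩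
    sumTo (suc n) (λ m → sumTo (suc n) (λ k → F k m) * X (n ∸ m))
      ≈⟨ sum-cong′ (suc n) (λ m → sym (sum-*ʳ (suc n) _ _)) ⟩
    sumTo (suc n) (λ m → sumTo (suc n) (λ k → F k m * X (n ∸ m)))
      ≈⟨ sum-swap (suc n) (suc n) _ ⟩
    Σ∞ (λ k → F k ⊛ X) n ∎

  cauchy : (ℕ → PS) → (ℕ → PS) → ℕ → PS
  cauchy F H k n = sumTo (suc k) (λ i → (F i ⊛ H (k ∸ i)) n)

  Σ∞-product : ∀ F H → Summable F → Summable H → Σ∞ F ⊛ Σ∞ H ≋ Σ∞ (cauchy F H)
  Σ∞-product F H sF sH n = begin
    (Σ∞ F ⊛ Σ∞ H) n
      ≈⟨ Σ∞-⊛ F (Σ∞ H) sF n ⟩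
    Σ∞ (λ i → F i ⊛ Σ∞ H) n
      ≈⟨ Σ∞-cong (λ i → ⊛-comm (F i) (Σ∞ H) ⟫ Σ∞-⊛ H (F i) sH ⟫ Σ∞-cong (λ j → ⊛-comm (H j) (F i))) n ⟩
    sumTo (suc n) (λ i → sumTo (suc n) (λ j → (F i ⊛ H j) n))
      ≈⟨ sum-cong (suc n) (λ i i<1+n → sum-pad _ (ℕ.m∸n≤m (suc n) i) (λ j n+1-i≤j →
           ⊛-vanishes i j (sF i) (sH j) n (ℕ.≤-trans (ℕ.≤-reflexive (≡.sym (ℕ.m+[n∸m]≡n (ℕ.<⇒≤ i<1+n))))
                                                   (ℕ.+-monoʳ-≤ i n+1-i≤j)))) ⟩
    sumTo (suc n) (λ i → sumTo (suc n ∸ i) (λ j → (F i ⊛ H j) n))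
      ≈⟨ sum-triangle (suc n) _ ⟩
    Σ∞ (cauchy F H) n ∎

  -- The reciprocal of a series D with D(0) = 1 is the geometric series in E = 1 - D:
  -- it satisfies R = 1 + E R, hence D R = R - E R = 1.
  recip-inverse : ∀ D → D 0 ≈ 1# → D ⊛ recip D ≋ oneS
  recip-inverse D D0≈1 = split D (recip D) ⟫ (λ n → +-congʳ (geometric n)) ⟫ cancel (oneS ⊖ D) (recip D)
    where
    open SeriesSolver using (solve; _:+_; _:*_; _:-_; _:=_; con)
    open import Data.Integer using (+_)
    E : PS
    E = oneS ⊖ D
    E-vanishes : Summable (pow E)
    E-vanishes = pow-vanishes (trans (+-congˡ (-‿cong D0≈1)) (-‿inverseʳ 1#))
    geometric : recip D ≋ oneS ⊕ E ⊛ recip D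
    geometric = Σ∞-head (pow E) E-vanishes
              ⟫ (λ n → +-congˡ ((Σ∞-cong (λ k → ⊛-comm E (pow E k)) ⟫ ≋-sym (Σ∞-⊛ (pow E) E E-vanishes)
                                  ⟫ ⊛-comm (recip D) E) n))
    split : ∀ D R → D ⊛ R ≋ R ⊕ (⊝ ((oneS ⊖ D) ⊛ R))
    split = solve 2 (λ D R → D :* R := R :- (con (+ 1) :- D) :* R) ≋-refl
    cancel : ∀ E R → (oneS ⊕ E ⊛ R) ⊕ (⊝ (E ⊛ R)) ≋ oneS
    cancel = solve 2 (λ E R → (con (+ 1) :+ E :* R) :- E :* R := con (+ 1)) ≋-refl

  fromℕ≈× : ∀ n → fromℕ n ≈ n × 1#
  fromℕ≈× zero    = refl
  fromℕ≈× (suc n) = trans (+-congˡ (fromℕ≈× n)) (sym (×-homo-+ 1# 1 n))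

  fromℕ-* : ∀ m n → fromℕ (m ℕ.* n) ≈ fromℕ m * fromℕ n
  fromℕ-* m n = trans (fromℕ≈× (m ℕ.* n)) (trans (×1-homo-* m n) (sym (*-cong (fromℕ≈× m) (fromℕ≈× n))))

  fromℕ-sum : ∀ m f → fromℕ (sumℕ m f) ≈ sumTo m (λ i → fromℕ (f i))
  fromℕ-sum zero    f = refl
  fromℕ-sum (suc m) f = begin
    fromℕ (sumℕ m f ℕ.+ f m)              ≈⟨ fromℕ≈× (sumℕ m f ℕ.+ f m) ⟩
    (sumℕ m f ℕ.+ f m) × 1#               ≈⟨ ×-homo-+ 1# (sumℕ m f) (f m) ⟩
    sumℕ m f × 1# + f m × 1#              ≈⟨ +-cong (fromℕ≈× (sumℕ m f)) (fromℕ≈× (f m)) ⟨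
    fromℕ (sumℕ m f) + fromℕ (f m)        ≈⟨ +-congʳ (fromℕ-sum m f) ⟩
    sumTo m (λ i → fromℕ (f i)) + fromℕ (f m) ∎

  scale : Carrier → PS → PS
  scale a X n = a * X n

  scale-vanishes : ∀ {k a X} → VanishesBelow k X → VanishesBelow k (scale a X)
  scale-vanishes X≈0 n n<k = trans (*-congˡ (X≈0 n n<k)) (zeroʳ _)

  scale-⊛-scale : ∀ a b X Y → scale a X ⊛ scale b Y ≋ scale (a * b) (X ⊛ Y)
  scale-⊛-scale a b X Y n =
    trans (sum-cong′ (suc n) (λ i → *-interchange a (X i) b (Y (n ∸ i)))) (sum-*ˡ (suc n) (a * b) _)

  ⊛-scale : ∀ a X Y → Y ⊛ scale a X ≋ scale a (Y ⊛ X)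
  ⊛-scale a X Y n = trans (sum-cong′ (suc n) (λ i → x∙yz≈y∙xz (Y i) a (X (n ∸ i)))) (sum-*ˡ (suc n) a _)

  module CatalanComposition (y : PS) (y0≈0 : y 0 ≈ 0#) where

    term : ℕ → PS
    term k = scale (fromℕ (catalan k)) (pow y k)

    term-summable : Summable term
    term-summable k = scale-vanishes (pow-vanishes y0≈0 k)

    term-convolution : ∀ k → cauchy term term k ≋ scale (fromℕ (catalan (suc k))) (pow y k)
    term-convolution k n = begin
      sumTo (suc k) (λ i → (term i ⊛ term (k ∸ i)) n)
        ≈⟨ sum-cong (suc k) (λ i i<1+k → trans (scale-⊛-scale _ _ (pow y i) (pow y (k ∸ i)) n)
             (*-congˡ (trans (sym (pow-+ y i (k ∸ i) n))
                             (reflexive (≡.cong (λ j → pow y j n) (ℕ.m+[n∸m]≡n (ℕ.≤-pred i<1+k))))))) ⟩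
      sumTo (suc k) (λ i → (C i * C (k ∸ i)) * pow y k n)
        ≈⟨ sum-*ʳ (suc k) _ _ ⟩
      sumTo (suc k) (λ i → C i * C (k ∸ i)) * pow y k n
        ≈⟨ *-congʳ (sum-cong′ (suc k) (λ i → fromℕ-* (catalan i) (catalan (k ∸ i)))) ⟨
      sumTo (suc k) (λ i → fromℕ (catalan i ℕ.* catalan (k ∸ i))) * pow y k n
        ≈⟨ *-congʳ (fromℕ-sum (suc k) _) ⟨
      fromℕ (sumℕ (suc k) (λ i → catalan i ℕ.* catalan (k ∸ i))) * pow y k n
        ≈⟨ *-congʳ (reflexive (≡.cong fromℕ (catalan-convolution k))) ⟨
      C (suc k) * pow y k n ∎
      where
      C : ℕ → Carrier
      C i = fromℕ (catalan i)

    convolution-summable : Summable (cauchy term term)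
    convolution-summable k = vanishes-cong (term-convolution k) (scale-vanishes (pow-vanishes y0≈0 k))

    catalan-equation : catalanOf y ≋ oneS ⊕ y ⊛ (catalanOf y ⊛ catalanOf y)
    catalan-equation = Σ∞-head term term-summable ⟫ λ n → +-cong (first-term n) (higher-terms n)
      where
      first-term : term 0 ≋ oneS
      first-term n = trans (*-congʳ (+-identityʳ 1#)) (*-identityˡ _)
      higher-terms : Σ∞ (λ k → term (suc k)) ≋ y ⊛ (catalanOf y ⊛ catalanOf y)
      higher-terms = Σ∞-cong (λ k → ≋-sym (⊛-scale _ (pow y k) y) ⟫ ⊛-cong {y} ≋-refl (≋-sym (term-convolution k))
                                      ⟫ ⊛-comm y (cauchy term term k))
                   ⟫ ≋-sym (Σ∞-⊛ (cauchy term term) y convolution-summable)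
                   ⟫ ⊛-comm _ y
                   ⟫ ⊛-cong {y} ≋-refl (≋-sym (Σ∞-product term term term-summable term-summable))

  cubic-coefficient : ∀ c₀ c₁ c₂ c₃ H n → (cubic c₀ c₁ c₂ c₃ ⊛ H) (3 ℕ.+ n)
                      ≈ c₀ * H (3 ℕ.+ n) + c₁ * H (2 ℕ.+ n) + c₂ * H (1 ℕ.+ n) + c₃ * H n
  cubic-coefficient c₀ c₁ c₂ c₃ H n = begin
    (cubic c₀ c₁ c₂ c₃ ⊛ H) (3 ℕ.+ n)
      ≈⟨ sum-head (3 ℕ.+ n) _ ⟩
    c₀ * H (3 ℕ.+ n) + sumTo (3 ℕ.+ n) (λ i → cubic c₀ c₁ c₂ c₃ (suc i) * H (2 ℕ.+ n ∸ i))
      ≈⟨ +-congˡ (sum-head (2 ℕ.+ n) _) ⟩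
    c₀ * H (3 ℕ.+ n) + (c₁ * H (2 ℕ.+ n) + sumTo (2 ℕ.+ n) (λ i → cubic c₀ c₁ c₂ c₃ (2 ℕ.+ i) * H (1 ℕ.+ n ∸ i)))
      ≈⟨ +-congˡ (+-congˡ (sum-head (1 ℕ.+ n) _)) ⟩
    c₀ * H (3 ℕ.+ n) + (c₁ * H (2 ℕ.+ n) + (c₂ * H (1 ℕ.+ n) + sumTo (1 ℕ.+ n) (λ i → cubic c₀ c₁ c₂ c₃ (3 ℕ.+ i) * H (n ∸ i))))
      ≈⟨ +-congˡ (+-congˡ (+-congˡ (trans (sum-head n _) (+-congˡ (sum-zero n _ (λ i _ → zeroˡ _)))))) ⟩
    c₀ * H (3 ℕ.+ n) + (c₁ * H (2 ℕ.+ n) + (c₂ * H (1 ℕ.+ n) + (c₃ * H n + 0#)))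
      ≈⟨ reassociate _ _ _ _ ⟩
    c₀ * H (3 ℕ.+ n) + c₁ * H (2 ℕ.+ n) + c₂ * H (1 ℕ.+ n) + c₃ * H n ∎
    where
    reassociate : ∀ a b c d → a + (b + (c + (d + 0#))) ≈ a + b + c + d
    reassociate a b c d = trans (+-congˡ (+-congˡ (+-congˡ (+-identityʳ d))))
                                (sym (trans (+-assoc _ c d) (+-assoc a b (c + d))))

  square-coefficient : ∀ H n → (H ⊛ H) (suc n)
                       ≈ H 0 * H (suc n) + sumTo n (λ i → H (suc i) * H (n ∸ i)) + H (suc n) * H 0
  square-coefficient H n = +-cong (sum-head n _) (*-congˡ (reflexive (≡.cong H (ℕ.n∸n≡0 n))))

module GeneratingFunction {c ℓ : Level} (R : CommutativeRing c ℓ) where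
  open import Data.Nat as ℕ using (_∸_; _≤_; _<_; s≤s; z≤n)
  import Data.Nat.Properties as ℕ
  open import Data.Nat.Induction using (<-rec)
  open import Data.Integer using (+_)
  open CommutativeRing R
  open PowerSeries R
  open FormalPowerSeries R
  open import Relation.Binary.Reasoning.Setoid setoid

  module _ (u v w t : Carrier) where

    Recurrence : PS → Set ℓ
    Recurrence a = ∀ n → a (suc (suc (suc (suc n)))) ≈
                     u * a (suc (suc (suc n))) + v * a (suc (suc n)) + w * a (suc n)
                     + t * sumTo n (λ i → a (suc i) * a (n ∸ i))

    recurrence-unique : ∀ a b → Recurrence a → Recurrence b →
                        a 0 ≈ b 0 → a 1 ≈ b 1 → a 2 ≈ b 2 → a 3 ≈ b 3 → a ≋ b
    recurrence-unique a b rec-a rec-b a0 a1 a2 a3 = <-rec (λ n → a n ≈ b n) agree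
      where
      agree : ∀ n → (∀ {m} → m < n → a m ≈ b m) → a n ≈ b n
      agree 0 _ = a0
      agree 1 _ = a1
      agree 2 _ = a2
      agree 3 _ = a3
      agree (suc (suc (suc (suc n)))) ih = begin
        a (4 ℕ.+ n)                                                              ≈⟨ rec-a n ⟩
        u * a (3 ℕ.+ n) + v * a (2 ℕ.+ n) + w * a (1 ℕ.+ n) + t * sumTo n (λ i → a (suc i) * a (n ∸ i))
          ≈⟨ +-cong (+-cong (+-cong (*-congˡ (earlier ℕ.≤-refl)) (*-congˡ (earlier (ℕ.m≤n+m (2 ℕ.+ n) 1))))
                            (*-congˡ (earlier (ℕ.m≤n+m (1 ℕ.+ n) 2))))
                    (*-congˡ (sum-cong n (λ i i<n → *-cong (earlier (ℕ.≤-trans i<n (ℕ.m≤n+m n 3)))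
                                                         (earlier (ℕ.≤-trans (ℕ.m∸n≤m n i) (ℕ.m≤n+m n 3)))))) ⟩
        u * b (3 ℕ.+ n) + v * b (2 ℕ.+ n) + w * b (1 ℕ.+ n) + t * sumTo n (λ i → b (suc i) * b (n ∸ i))
          ≈⟨ rec-b n ⟨
        b (4 ℕ.+ n) ∎
        where
        earlier : ∀ {m} → m ≤ 3 ℕ.+ n → a m ≈ b m
        earlier m≤ = ih (s≤s m≤)

  module _ (p q s u v w t : Carrier) where
    private
      N D T Y G : PS
      N = Npoly p q s u v w t
      D = Dpoly p q s u v w t
      T = cx³ t
      Y = T ⊛ N ⊛ recip D ⊛ recip D
      G = genFun p q s u v w t

    -- From G = (N/D) c(Y) and c = 1 + Y c²:  D G = N c(Y) = N + T G².
    functional-equation : D ⊛ G ≋ N ⊕ T ⊛ (G ⊛ G)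
    functional-equation =
        regroup D N (recip D) C
      ⟫ ⊛-cong (recip-inverse D refl) (⊛-cong {N} ≋-refl (catalan-equation))
      ⟫ expand T N (recip D) C
      where
      open SeriesSolver using (solve; _:+_; _:*_; _:=_; con)
      T-vanishes : VanishesBelow 1 T
      T-vanishes 0       _         = refl
      T-vanishes (suc n) (s≤s ())
      Y0≈0 : Y 0 ≈ 0#
      Y0≈0 = ⊛-vanishesˡ (recip D) (⊛-vanishesˡ (recip D) (⊛-vanishesˡ N T-vanishes)) 0 (s≤s z≤n)
      open CatalanComposition Y Y0≈0
      C : PS
      C = catalanOf Y
      regroup : ∀ D N R C → D ⊛ ((N ⊛ R) ⊛ C) ≋ (D ⊛ R) ⊛ (N ⊛ C)
      regroup = solve 4 (λ D N R C → D :* ((N :* R) :* C) := (D :* R) :* (N :* C)) ≋-refl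
      expand : ∀ T N R C → oneS ⊛ (N ⊛ (oneS ⊕ (T ⊛ N ⊛ R ⊛ R) ⊛ (C ⊛ C)))
                           ≋ N ⊕ T ⊛ (((N ⊛ R) ⊛ C) ⊛ ((N ⊛ R) ⊛ C))
      expand = solve 4 (λ T N R C → con (+ 1) :* (N :* (con (+ 1) :+ (T :* N :* R :* R) :* (C :* C)))
                                    := N :+ T :* (((N :* R) :* C) :* ((N :* R) :* C))) ≋-refl

    private
      GG : PS
      GG = G ⊛ G
      open CoefficientSolver using (solve; _:+_; _:*_; _:-_; :-_; _:=_; con)
      w′ : Carrier
      w′ = w - (t + t)

    genFun-0 : G 0 ≈ 1#
    genFun-0 = begin
      G 0                         ≈⟨ trans (+-identityˡ _) (*-identityˡ _) ⟨
      0# + 1# * G 0               ≈⟨ functional-equation 0 ⟩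
      1# + (0# + 0# * GG 0)       ≈⟨ trans (+-congˡ (trans (+-identityˡ _) (zeroˡ _))) (+-identityʳ 1#) ⟩
      1# ∎

    genFun-1 : G 1 ≈ p
    genFun-1 = begin
      G 1                                                ≈⟨ isolate (G 1) (G 0) u ⟩
      (0# + 1# * G 1) + (- u) * G 0 + u * G 0            ≈⟨ +-cong (functional-equation 1) (*-congˡ genFun-0) ⟩
      (p - u) + ((0# + 0# * GG 1) + 0# * GG 0) + u * 1#  ≈⟨ evaluate p u (GG 1) (GG 0) ⟩
      p ∎
      where
      isolate : ∀ x y u → x ≈ (0# + 1# * x) + (- u) * y + u * y
      isolate = solve 3 (λ x y u → x := (con (+ 0) :+ con (+ 1) :* x) :+ (:- u) :* y :+ u :* y) refl
      evaluate : ∀ p u X Y → (p - u) + ((0# + 0# * X) + 0# * Y) + u * 1# ≈ p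
      evaluate = solve 4 (λ p u X Y → (p :- u) :+ ((con (+ 0) :+ con (+ 0) :* X) :+ con (+ 0) :* Y) :+ u :* con (+ 1)
                                      := p) refl

    genFun-2 : G 2 ≈ q
    genFun-2 = begin
      G 2                                                   ≈⟨ isolate (G 2) (G 1) (G 0) u v ⟩
      (0# + 1# * G 2) + (- u) * G 1 + (- v) * G 0 + (u * G 1 + v * G 0)
        ≈⟨ +-cong (functional-equation 2) (+-cong (*-congˡ genFun-1) (*-congˡ genFun-0)) ⟩
      - (v + p * u - q) + ((0# + 0# * GG 2) + 0# * GG 1 + 0# * GG 0) + (u * p + v * 1#)
        ≈⟨ evaluate p q u v (GG 2) (GG 1) (GG 0) ⟩
      q ∎
      where
      isolate : ∀ x y z u v → x ≈ (0# + 1# * x) + (- u) * y + (- v) * z + (u * y + v * z)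
      isolate = solve 5 (λ x y z u v → x := (con (+ 0) :+ con (+ 1) :* x) :+ (:- u) :* y :+ (:- v) :* z
                                             :+ (u :* y :+ v :* z)) refl
      evaluate : ∀ p q u v X Y Z →
                 - (v + p * u - q) + ((0# + 0# * X) + 0# * Y + 0# * Z) + (u * p + v * 1#) ≈ q
      evaluate = solve 7 (λ p q u v X Y Z →
        :- (v :+ p :* u :- q) :+ ((con (+ 0) :+ con (+ 0) :* X) :+ con (+ 0) :* Y :+ con (+ 0) :* Z)
        :+ (u :* p :+ v :* con (+ 1)) := q) refl

    isolate-from-3 : ∀ n → G (3 ℕ.+ n) ≈ (D ⊛ G) (3 ℕ.+ n) + (u * G (2 ℕ.+ n) + v * G (1 ℕ.+ n) + w′ * G n)
    isolate-from-3 n = trans (isolate (G (3 ℕ.+ n)) (G (2 ℕ.+ n)) (G (1 ℕ.+ n)) (G n) u v w′)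
                             (+-congʳ (sym (cubic-coefficient 1# (- u) (- v) (- w′) G n)))
      where
      isolate : ∀ x y z o u v w′ → x ≈ (1# * x + (- u) * y + (- v) * z + (- w′) * o) + (u * y + v * z + w′ * o)
      isolate = solve 7 (λ x y z o u v w′ → x := (con (+ 1) :* x :+ (:- u) :* y :+ (:- v) :* z :+ (:- w′) :* o)
                                                  :+ (u :* y :+ v :* z :+ w′ :* o)) refl

    genFun-3 : G 3 ≈ s
    genFun-3 = begin
      G 3                                           ≈⟨ isolate-from-3 0 ⟩
      (D ⊛ G) 3 + (u * G 2 + v * G 1 + w′ * G 0)
        ≈⟨ +-cong (trans (functional-equation 3) (+-congˡ (+-congˡ (*-congˡ GG0≈1))))
                  (+-cong (+-cong (*-congˡ genFun-2) (*-congˡ genFun-1)) (*-congˡ genFun-0)) ⟩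
      - (w - s - t + q * u + p * v) + ((0# + 0# * GG 3) + 0# * GG 2 + 0# * GG 1 + t * 1#)
        + (u * q + v * p + w′ * 1#)
        ≈⟨ evaluate p q s u v w t (GG 3) (GG 2) (GG 1) ⟩
      s ∎
      where
      GG0≈1 : GG 0 ≈ 1#
      GG0≈1 = trans (+-identityˡ _) (trans (*-cong genFun-0 genFun-0) (*-identityˡ 1#))
      evaluate : ∀ p q s u v w t X Y Z →
        - (w - s - t + q * u + p * v) + ((0# + 0# * X) + 0# * Y + 0# * Z + t * 1#)
        + (u * q + v * p + (w - (t + t)) * 1#) ≈ s
      evaluate = solve 10 (λ p q s u v w t X Y Z →
        :- (w :- s :- t :+ q :* u :+ p :* v) :+ ((con (+ 0) :+ con (+ 0) :* X) :+ con (+ 0) :* Y :+ con (+ 0) :* Z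
        :+ t :* con (+ 1)) :+ (u :* q :+ v :* p :+ (w :- (t :+ t)) :* con (+ 1)) := s) refl

    genFun-recurrence : Recurrence u v w t G
    genFun-recurrence n = begin
      G (4 ℕ.+ n)
        ≈⟨ isolate-from-3 (suc n) ⟩
      (D ⊛ G) (4 ℕ.+ n) + (u * g₃ + v * g₂ + w′ * g₁)
        ≈⟨ +-congʳ (trans (functional-equation (4 ℕ.+ n)) (+-congˡ quadratic-part)) ⟩
      (0# + (0# * GG (4 ℕ.+ n) + 0# * GG (3 ℕ.+ n) + 0# * GG (2 ℕ.+ n) + t * (1# * g₁ + S + g₁ * 1#)))
        + (u * g₃ + v * g₂ + w′ * g₁)
        ≈⟨ evaluate g₃ g₂ g₁ u v w t (GG (4 ℕ.+ n)) (GG (3 ℕ.+ n)) (GG (2 ℕ.+ n)) S ⟩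
      u * g₃ + v * g₂ + w * g₁ + t * S ∎
      where
      g₁ g₂ g₃ S : Carrier
      g₁ = G (1 ℕ.+ n)
      g₂ = G (2 ℕ.+ n)
      g₃ = G (3 ℕ.+ n)
      S  = sumTo n (λ i → G (suc i) * G (n ∸ i))
      -- Only the x³ term of T contributes, and G(0) = 1 in the square.
      quadratic-part : (T ⊛ GG) (4 ℕ.+ n)
        ≈ 0# * GG (4 ℕ.+ n) + 0# * GG (3 ℕ.+ n) + 0# * GG (2 ℕ.+ n) + t * (1# * g₁ + S + g₁ * 1#)
      quadratic-part = trans (cubic-coefficient 0# 0# 0# t GG (suc n))
        (+-congˡ (*-congˡ (trans (square-coefficient G n) (+-cong (+-congʳ (*-congʳ genFun-0)) (*-congˡ genFun-0)))))
      evaluate : ∀ y z o u v w t A B C S →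
        (0# + (0# * A + 0# * B + 0# * C + t * (1# * o + S + o * 1#))) + (u * y + v * z + (w - (t + t)) * o)
        ≈ u * y + v * z + w * o + t * S
      evaluate = solve 11 (λ y z o u v w t A B C S →
        (con (+ 0) :+ (con (+ 0) :* A :+ con (+ 0) :* B :+ con (+ 0) :* C
                       :+ t :* (con (+ 1) :* o :+ S :+ o :* con (+ 1))))
        :+ (u :* y :+ v :* z :+ (w :- (t :+ t)) :* o) := u :* y :+ v :* z :+ w :* o :+ t :* S) refl

    recurrence-solution : ∀ a → Recurrence u v w t a → a 0 ≈ 1# → a 1 ≈ p → a 2 ≈ q → a 3 ≈ s → a ≋ G
    recurrence-solution a recurrence a0 a1 a2 a3 =
      recurrence-unique u v w t a G recurrence genFun-recurrence
        (trans a0 (sym genFun-0)) (trans a1 (sym genFun-1)) (trans a2 (sym genFun-2)) (trans a3 (sym genFun-3))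

mainTheorem11 : {c ℓ : Level} (R : CommutativeRing c ℓ) →
    let open CommutativeRing R
        open PowerSeries R
    in (p q s u v w t : Carrier) → ¬ (t ≈ 0#) →
       (a : ℕ → Carrier) →
       a 0 ≈ 1# → a 1 ≈ p → a 2 ≈ q → a 3 ≈ s →
       (∀ n → a (suc (suc (suc (suc n)))) ≈
                u * a (suc (suc (suc n))) + v * a (suc (suc n)) + w * a (suc n)
                + t * sumTo n (λ i → a (suc i) * a (n Data.Nat.∸ i))) →
       ∀ n → a n ≈ genFun p q s u v w t n
mainTheorem11 R p q s u v w t _ a a0 a1 a2 a3 recurrence =
  recurrence-solution p q s u v w t a recurrence a0 a1 a2 a3
  where open GeneratingFunction R
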